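{- It is not the case that FLATS $\leq$ NON-SPANNING CIRCUITS; that is, there is no Turing machine running in time polynomial in its input length which, for every matroid $M$, given the list of all flats of $M$ outputs the rank of $M$ together with the list of all non-spanning circuits of $M$.
   Context: All matroids are finite. A matroid is described to a Turing machine by a list of subsets of its ground set $E$ ($|E| = n$), each subset encoded by its characteristic vector, with a reasonable encoding (no padding), so a description listing $i$ subsets has length $\Theta(ni)$. The NON-SPANNING CIRCUITS description consists of $r(M)$ and the list of all non-spanning circuits (only $r(M)$ if there are none). For two description types $I_1, I_2$, $I_1 \leq I_2$ means there is a polynomial-time Turing machine producing the $I_2$-description of $M$ from the $I_1$-description of $M$, for every matroid $M$. -}

module Defs where

open import Data.Nat using (ℕ; zero; suc; _+_; _*_; _^_; _≤_; _<_)
open import Data.Fin using (Fin)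
open import Data.Fin.Subset using (Subset; _∈_; _∉_; _⊆_; _⊂_; _∪_; ⁅_⁆; ∣_∣; ⊥; ⊤)
open import Data.Bool using (Bool; true; false)
open import Data.Vec using (Vec; []; _∷_)
open import Data.List using (List; []; _∷_; _++_; map; concat; length; replicate)
open import Data.List.Relation.Unary.Unique.Propositional using (Unique)
import Data.List.Membership.Propositional as LMem
open import Data.Maybe using (Maybe; just; nothing)
open import Data.Product using (Σ; ∃; ∃-syntax; _×_; _,_)
open import Relation.Nullary using (¬_)
open import Relation.Binary.PropositionalEquality using (_≡_)

record Matroid (n : ℕ) : Set₁ where
  field
    Indep    : Subset n → Set
    indep-⊥  : Indep ⊥
    indep-⊆  : ∀ {I J} → J ⊆ I → Indep I → Indep J
    augment  : ∀ {I J} → Indep I → Indep J → ∣ I ∣ < ∣ J ∣ →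
               ∃[ e ] (e ∈ J × e ∉ I × Indep (I ∪ ⁅ e ⁆))

module _ {n : ℕ} (M : Matroid n) where
  open Matroid M

  HasRank : Subset n → ℕ → Set
  HasRank X r = (∃[ I ] (I ⊆ X × Indep I × ∣ I ∣ ≡ r))
              × (∀ I → I ⊆ X → Indep I → ∣ I ∣ ≤ r)

  MatroidRank : ℕ → Set
  MatroidRank r = HasRank ⊤ r

  IsFlat : Subset n → Set
  IsFlat F = ∀ e → e ∉ F → ∀ r r' → HasRank F r → HasRank (F ∪ ⁅ e ⁆) r' → r < r'

  IsCircuit : Subset n → Set
  IsCircuit C = ¬ Indep C × (∀ D → D ⊂ C → Indep D)

  IsNonSpanningCircuit : Subset n → Set
  IsNonSpanningCircuit C = IsCircuit C ×
    (∀ r rM → HasRank C r → MatroidRank rM → r < rM)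

  ListsExactly : (Subset n → Set) → List (Subset n) → Set
  ListsExactly P L = Unique L × (∀ X → (X LMem.∈ L → P X) × (P X → X LMem.∈ L))

data Sym : Set where
  s0 s1 s# : Sym

bitsOf : ∀ {n} → Subset n → List Sym
bitsOf [] = []
bitsOf (false ∷ v) = s0 ∷ bitsOf v
bitsOf (true ∷ v) = s1 ∷ bitsOf v

encodeSets : ∀ {n} → List (Subset n) → List Sym
encodeSets L = concat (map (λ X → bitsOf X ++ (s# ∷ [])) L)

encodeNSC : ∀ {n} → ℕ → List (Subset n) → List Sym
encodeNSC r L = replicate r s1 ++ (s# ∷ []) ++ encodeSets L

-- Deterministic single-tape Turing machines (two-way infinite tape).
-- Tape alphabet Fin (4 + Γ): 0 = blank, 1 = '0', 2 = '1', 3 = '#'.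

data Move : Set where
  left right : Move

record TM : Set where
  field
    Q : ℕ                       -- states Fin (suc Q), start state zero
    Γ : ℕ                       -- number of extra work symbols
    δ : Fin (suc Q) → Fin (4 + Γ) →
        Maybe (Fin (suc Q) × Fin (4 + Γ) × Move)   -- nothing = halt

module _ (T : TM) where
  open TM T

  Tape : Set
  Tape = Fin (4 + Γ)

  blank : Tape
  blank = Fin.zero
    where import Data.Fin as Fin

  symT : Sym → Tape
  symT s0 = Data.Fin.suc Data.Fin.zero
  symT s1 = Data.Fin.suc (Data.Fin.suc Data.Fin.zero)
  symT s# = Data.Fin.suc (Data.Fin.suc (Data.Fin.suc Data.Fin.zero))

  -- configuration: state, cells left of head (nearest first), head cell,
  -- cells right of head (nearest first); unlisted cells are blank
  record Config : Set where
    constructor cfg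
    field
      state : Fin (suc Q)
      lft   : List Tape
      hd    : Tape
      rgt   : List Tape

  initial : List Sym → Config
  initial []      = cfg Data.Fin.zero [] blank []
  initial (s ∷ w) = cfg Data.Fin.zero [] (symT s) (map symT w)

  moveHead : Move → List Tape → Tape → List Tape → (List Tape × Tape × List Tape)
  moveHead left  []      a r = [] , blank , a ∷ r
  moveHead left  (b ∷ l) a r = l , b , a ∷ r
  moveHead right l a []      = a ∷ l , blank , []
  moveHead right l a (b ∷ r) = a ∷ l , b , r

  step : Config → Maybe Config
  step (cfg q l a r) with δ q a
  ... | nothing = nothing
  ... | just (q' , b , m) with moveHead m l b r
  ...   | (l' , a' , r') = just (cfg q' l' a' r')

  data HaltsIn : ℕ → Config → Config → Set where
    halt-now : ∀ {c} → step c ≡ nothing → HaltsIn zero c c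
    halt-step : ∀ {t c c₁ c'} → step c ≡ just c₁ → HaltsIn t c₁ c' → HaltsIn (suc t) c c'

  Outputs : Config → List Sym → Set
  Outputs (cfg q l a r) w = ∃[ k ] (a ∷ r ≡ map symT w ++ replicate k blank)

  ComputesWithin : ℕ → List Sym → List Sym → Set
  ComputesWithin bound w w' =
    ∃[ t ] ∃[ c ] (t ≤ bound × HaltsIn t (initial w) c × Outputs c w')

FlatsReducesToNSC : Set₁
FlatsReducesToNSC =
  ∃[ T ] ∃[ c ] ∃[ k ]
    (∀ n (M : Matroid n) (LF : List (Subset n)) → ListsExactly M (IsFlat M) LF →
      let w = encodeSets LF in
      ∃[ r ] ∃[ LC ] (MatroidRank M r × ListsExactly M (IsNonSpanningCircuit M) LC ×
        ComputesWithin T (c * length w ^ k + c) w (encodeNSC r LC)))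

-- A Turing machine halting within t steps writes at most (input length) + t + 1 symbols, so a
-- polynomial-time reduction bounds the number of non-spanning circuits polynomially in the length
-- of the FLATS description. Take m classes of 2^m elements each, call a set independent when it
-- meets every class at most once and has fewer than m elements, and add a coloop. A flat is
-- determined by whether it contains the coloop and by the classes it meets, so there are at most
-- 2^(m+1) flats and the FLATS description has length at most 2^(4m); but each of the
-- (2^m)^m = 2^(m·m) full transversals is a circuit, non-spanning because of the coloop.

{-# OPTIONS --safe #-}
module Submission where

open import Defs
open import Data.Fin using (Fin; zero; suc; combine; quotient; finToFun; funToFin)
open import Data.Fin.Properties
  using (all?; any?; injective⇒≤; combine-injective; combine-injectiveˡ; remQuot-combine; funToFin-finToFin)
  renaming (_≟_ to _≟ᶠ_)
import Data.Fin.Properties as Finₚ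
open import Data.Fin.Subset using (Subset; inside; outside; _∈_; _∉_; _⊆_; _⊂_; _∪_; _─_; _-_; ⁅_⁆; ∣_∣; ⊥; ⊤)
open import Data.Fin.Subset.Properties
open import Data.List using (List; []; _∷_; _++_; map; length; lookup; replicate; filter)
open import Data.List.Properties using (length-map; length-++; length-++-≤ʳ; length-replicate)
open import Data.List.Membership.Propositional using () renaming (_∈_ to _∈ₗ_)
open import Data.List.Membership.Propositional.Properties
  using (∈-filter⁺; ∈-filter⁻; ∈-map⁺; ∈-map⁻; ∈-++⁺ˡ; ∈-++⁺ʳ; ∈-lookup)
open import Data.List.Relation.Unary.All as All using ([])
open import Data.List.Relation.Unary.AllPairs using ([]; _∷_)
open import Data.List.Relation.Unary.Any using (here; there; index)
open import Data.List.Relation.Unary.Any.Properties using (lookup-index)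
open import Data.List.Relation.Unary.Unique.Propositional using (Unique)
import Data.List.Relation.Unary.Unique.Propositional.Properties as Unique
open import Data.Maybe using (just)
open import Data.Nat using (ℕ; zero; suc; _+_; _*_; _^_; _≤_; _<_; z≤n; s≤s; _≤?_; _<?_; NonZero; >-nonZero)
open import Data.Nat.Tactic.RingSolver using (solve-∀)
open import Data.Nat.Properties
open import Data.Product using (∃-syntax; _×_; _,_; proj₁; proj₂)
open import Data.Sum using (_⊎_; inj₁; inj₂; map₂)
open import Data.Vec using ([]; _∷_; here; there; tail)
open import Data.Vec.Properties using (∷-injective)
open import Function using (_∘_; _$_)
open import Function.Definitions using (Injective)
open import Relation.Binary.PropositionalEquality
open import Relation.Nullary using (¬_; ¬?; yes; no; contradiction)
open import Relation.Nullary.Decidable using (_×-dec_; _→-dec_; map′)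
open import Relation.Unary using (Decidable)

-- Lengths of computations and encodings

module _ (T : TM) where

  tapeLength : Config T → ℕ
  tapeLength (cfg _ l _ r) = length l + length r

  moveHead-length : ∀ d (l : List (Tape T)) a r → let (l' , _ , r') = moveHead T d l a r in
                    length l' + length r' ≤ suc (length l + length r)
  moveHead-length left  []      a r = ≤-refl
  moveHead-length left  (b ∷ l) a r = ≤-trans (≤-reflexive (+-suc (length l) (length r))) (n≤1+n _)
  moveHead-length right l       a []      = ≤-refl
  moveHead-length right l       a (b ∷ r) = ≤-trans (≤-reflexive (sym (+-suc (length l) (length r)))) (n≤1+n _)

  step-length : ∀ c {c'} → step T c ≡ just c' → tapeLength c' ≤ suc (tapeLength c)
  step-length (cfg q l a r) eq with TM.δ T q a
  ... | just (_ , b , d) with moveHead T d l b r | moveHead-length d l b r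
  ...   | _ | bound with refl ← eq = bound

  HaltsIn-length : ∀ {t c c'} → HaltsIn T t c c' → tapeLength c' ≤ tapeLength c + t
  HaltsIn-length {c = c} (halt-now _) = m≤m+n (tapeLength c) 0
  HaltsIn-length {suc t} {c} (halt-step {c₁ = c₁} {c' = c'} stepped halts) = begin
    tapeLength c'           ≤⟨ HaltsIn-length halts ⟩
    tapeLength c₁ + t       ≤⟨ +-monoˡ-≤ t (step-length c stepped) ⟩
    suc (tapeLength c) + t  ≡⟨ +-suc (tapeLength c) t ⟨
    tapeLength c + suc t    ∎
    where open ≤-Reasoning

  initial-length : ∀ w → tapeLength (initial T w) ≤ length w
  initial-length []      = z≤n
  initial-length (s ∷ w) = ≤-trans (≤-reflexive (length-map (symT T) w)) (n≤1+n _)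

  Outputs-length : ∀ c {w} → Outputs T c w → length w ≤ suc (tapeLength c)
  Outputs-length (cfg _ l a r) {w} (k , eq) = begin
    length w
      ≤⟨ m≤m+n _ _ ⟩
    length w + k
      ≡⟨ cong₂ _+_ (length-map (symT T) w) (length-replicate k) ⟨
    length (map (symT T) w) + length (replicate k (blank T))
      ≡⟨ length-++ (map (symT T) w) ⟨
    length (map (symT T) w ++ replicate k (blank T))
      ≡⟨ cong length eq ⟨
    suc (length r)
      ≤⟨ s≤s (m≤n+m _ _) ⟩
    suc (length l + length r) ∎
    where open ≤-Reasoning

  ComputesWithin-length : ∀ {bound w w'} → ComputesWithin T bound w w' →
                          length w' ≤ suc (length w + bound)
  ComputesWithin-length {bound} {w} {w'} (t , c , t≤bound , halts , outputs) = begin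
    length w'                          ≤⟨ Outputs-length c outputs ⟩
    suc (tapeLength c)                 ≤⟨ s≤s (HaltsIn-length halts) ⟩
    suc (tapeLength (initial T w) + t) ≤⟨ s≤s (+-mono-≤ (initial-length w) t≤bound) ⟩
    suc (length w + bound)             ∎
    where open ≤-Reasoning

length-bitsOf : ∀ {n} (p : Subset n) → length (bitsOf p) ≡ n
length-bitsOf []            = refl
length-bitsOf (outside ∷ p) = cong suc (length-bitsOf p)
length-bitsOf (inside ∷ p)  = cong suc (length-bitsOf p)

length-encodeSets : ∀ {n} (L : List (Subset n)) → length (encodeSets L) ≡ length L * suc n
length-encodeSets [] = refl
length-encodeSets {n} (p ∷ L) = begin
  length ((bitsOf p ++ s# ∷ []) ++ encodeSets L)
    ≡⟨ length-++ (bitsOf p ++ s# ∷ []) ⟩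
  length (bitsOf p ++ s# ∷ []) + length (encodeSets L)
    ≡⟨ cong (_+ length (encodeSets L)) (length-++ (bitsOf p)) ⟩
  length (bitsOf p) + 1 + length (encodeSets L)
    ≡⟨ cong₂ (λ a b → a + 1 + b) (length-bitsOf p) (length-encodeSets L) ⟩
  n + 1 + length L * suc n
    ≡⟨ cong (_+ length L * suc n) (+-comm n 1) ⟩
  suc n + length L * suc n ∎
  where open ≡-Reasoning

length-≤-encodeNSC : ∀ {n} r (L : List (Subset n)) → length L ≤ length (encodeNSC r L)
length-≤-encodeNSC {n} r L = begin
  length L                               ≤⟨ m≤m*n (length L) (suc n) ⟩
  length L * suc n                       ≡⟨ length-encodeSets L ⟨
  length (encodeSets L)                  ≤⟨ n≤1+n _ ⟩
  length ((s# ∷ []) ++ encodeSets L)     ≤⟨ length-++-≤ʳ _ {replicate r s1} ⟩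
  length (encodeNSC r L)                 ∎
  where open ≤-Reasoning

-- Counting, and finite subsets

injective⇒≤length : ∀ {N} {B : Set} (ys : List B) (h : Fin N → B) →
                    Injective _≡_ _≡_ h → (∀ i → h i ∈ₗ ys) → N ≤ length ys
injective⇒≤length ys h h-injective h∈ys = injective⇒≤ {f = index ∘ h∈ys} λ {i} {j} eq →
  h-injective (trans (lookup-index (h∈ys i)) (trans (cong (lookup ys) eq) (sym (lookup-index (h∈ys j)))))

Unique⇒lookup-injective : ∀ {A : Set} {xs : List A} → Unique xs → Injective _≡_ _≡_ (lookup xs)
Unique⇒lookup-injective {xs = _ ∷ _} _            {zero}  {zero}  _  = refl
Unique⇒lookup-injective {xs = _ ∷ _} (x∉xs ∷ _)   {zero}  {suc j} eq =
  contradiction eq (All.lookup x∉xs (∈-lookup j))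
Unique⇒lookup-injective {xs = _ ∷ _} (x∉xs ∷ _)   {suc i} {zero}  eq =
  contradiction (sym eq) (All.lookup x∉xs (∈-lookup i))
Unique⇒lookup-injective {xs = _ ∷ _} (_ ∷ unique) {suc i} {suc j} eq =
  cong suc (Unique⇒lookup-injective unique eq)

allSubsets : ∀ n → List (Subset n)
allSubsets zero    = [] ∷ []
allSubsets (suc n) = map (inside ∷_) (allSubsets n) ++ map (outside ∷_) (allSubsets n)

∈-allSubsets : ∀ {n} (p : Subset n) → p ∈ₗ allSubsets n
∈-allSubsets []                    = here refl
∈-allSubsets         (inside ∷ p)  = ∈-++⁺ˡ (∈-map⁺ (inside ∷_) (∈-allSubsets p))
∈-allSubsets {suc n} (outside ∷ p) =
  ∈-++⁺ʳ (map (inside ∷_) (allSubsets n)) (∈-map⁺ (outside ∷_) (∈-allSubsets p))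

length-allSubsets : ∀ n → length (allSubsets n) ≡ 2 ^ n
length-allSubsets zero    = refl
length-allSubsets (suc n) = begin
  length (map (inside ∷_) (allSubsets n) ++ map (outside ∷_) (allSubsets n))
    ≡⟨ length-++ (map (inside ∷_) (allSubsets n)) ⟩
  length (map (inside ∷_) (allSubsets n)) + length (map (outside ∷_) (allSubsets n))
    ≡⟨ cong₂ _+_ (length-map _ (allSubsets n)) (length-map _ (allSubsets n)) ⟩
  length (allSubsets n) + length (allSubsets n)
    ≡⟨ cong (λ l → l + l) (length-allSubsets n) ⟩
  2 ^ n + 2 ^ n
    ≡⟨ cong (2 ^ n +_) (+-identityʳ (2 ^ n)) ⟨
  2 ^ suc n ∎
  where open ≡-Reasoning

allSubsets-unique : ∀ n → Unique (allSubsets n)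
allSubsets-unique zero    = [] ∷ []
allSubsets-unique (suc n) =
  Unique.++⁺ (Unique.map⁺ (proj₂ ∘ ∷-injective) (allSubsets-unique n))
             (Unique.map⁺ (proj₂ ∘ ∷-injective) (allSubsets-unique n))
             disjoint
  where
  disjoint : ∀ {p} → ¬ (p ∈ₗ map (inside ∷_) (allSubsets n) × p ∈ₗ map (outside ∷_) (allSubsets n))
  disjoint (p∈ , p∈') with ∈-map⁻ (inside ∷_) p∈ | ∈-map⁻ (outside ∷_) p∈'
  ... | _ , _ , refl | _ , _ , ()

private variable
  n m : ℕ

x∈p∪⁅y⁆⁻ : ∀ (p : Subset n) y {x} → x ∈ p ∪ ⁅ y ⁆ → x ∈ p ⊎ x ≡ y
x∈p∪⁅y⁆⁻ p y = map₂ (x∈⁅y⁆⇒x≡y y) ∘ x∈p∪q⁻ p ⁅ y ⁆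

x∈p─q⇒x∉q : ∀ (p q : Subset n) {x} → x ∈ p ─ q → x ∉ q
x∈p─q⇒x∉q (inside ∷ p) (outside ∷ q) here       ()
x∈p─q⇒x∉q (_ ∷ p)      (_ ∷ q)       (there x∈) (there x∈q) = x∈p─q⇒x∉q p q x∈ x∈q

x∈p-y⇒x≢y : ∀ (p : Subset n) {x y} → x ∈ p - y → x ≢ y
x∈p-y⇒x≢y p {y = y} x∈ = x∉⁅y⁆⇒x≢y (x∈p─q⇒x∉q p ⁅ y ⁆ x∈)

p⊆q∪⁅x⁆∧x∉p⇒p⊆q : ∀ {p q : Subset n} {x} → p ⊆ q ∪ ⁅ x ⁆ → x ∉ p → p ⊆ q
p⊆q∪⁅x⁆∧x∉p⇒p⊆q {q = q} {x} p⊆ x∉p {y} y∈p with x∈p∪⁅y⁆⁻ q x (p⊆ y∈p)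
... | inj₁ y∈q  = y∈q
... | inj₂ refl = contradiction y∈p x∉p

∣p∪⁅x⁆∣≡1+∣p∣ : ∀ (p : Subset n) {x} → x ∉ p → ∣ p ∪ ⁅ x ⁆ ∣ ≡ suc ∣ p ∣
∣p∪⁅x⁆∣≡1+∣p∣ (inside ∷ p)  {zero}  x∉p = contradiction here x∉p
∣p∪⁅x⁆∣≡1+∣p∣ (outside ∷ p) {zero}  _   = cong (suc ∘ ∣_∣) (∪-identityʳ p)
∣p∪⁅x⁆∣≡1+∣p∣ (inside ∷ p)  {suc x} x∉p = cong suc (∣p∪⁅x⁆∣≡1+∣p∣ p (x∉p ∘ there))
∣p∪⁅x⁆∣≡1+∣p∣ (outside ∷ p) {suc x} x∉p = ∣p∪⁅x⁆∣≡1+∣p∣ p (x∉p ∘ there)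

x∈p⇒1+∣p-x∣≡∣p∣ : ∀ (p : Subset n) {x} → x ∈ p → suc ∣ p - x ∣ ≡ ∣ p ∣
x∈p⇒1+∣p-x∣≡∣p∣ (inside ∷ p) here            = cong (suc ∘ ∣_∣) (p─⊥≡p p)
x∈p⇒1+∣p-x∣≡∣p∣ (inside ∷ p)  (there x∈p) = cong suc (x∈p⇒1+∣p-x∣≡∣p∣ p x∈p)
x∈p⇒1+∣p-x∣≡∣p∣ (outside ∷ p) (there x∈p) = x∈p⇒1+∣p-x∣≡∣p∣ p x∈p

∣p-x∪⁅y⁆∣≡∣p∣ : ∀ (p : Subset n) {x y} → x ∈ p → y ∉ p - x → ∣ (p - x) ∪ ⁅ y ⁆ ∣ ≡ ∣ p ∣
∣p-x∪⁅y⁆∣≡∣p∣ p x∈p y∉p-x = trans (∣p∪⁅x⁆∣≡1+∣p∣ _ y∉p-x) (x∈p⇒1+∣p-x∣≡∣p∣ p x∈p)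

∣p∣<∣q∣⇒∃x∈q∖p : ∀ {p q : Subset n} → ∣ p ∣ < ∣ q ∣ → ∃[ x ] (x ∈ q × x ∉ p)
∣p∣<∣q∣⇒∃x∈q∖p {p = p} {q} ∣p∣<∣q∣ with any? (λ x → x ∈? q ×-dec ¬? (x ∈? p))
... | yes found = found
... | no ¬found = contradiction (p⊆q⇒∣p∣≤∣q∣ q⊆p) (<⇒≱ ∣p∣<∣q∣)
  where
  q⊆p : q ⊆ p
  q⊆p {x} x∈q with x ∈? p
  ... | yes x∈p = x∈p
  ... | no x∉p  = contradiction (x , x∈q , x∉p) ¬found

image : (Fin n → Fin m) → Subset n → Subset m
image f []            = ⊥
image f (outside ∷ p) = image (f ∘ suc) p
image f (inside ∷ p)  = image (f ∘ suc) p ∪ ⁅ f zero ⁆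

∈-image⁺ : ∀ (f : Fin n → Fin m) {p x} → x ∈ p → f x ∈ image f p
∈-image⁺ f {inside ∷ p}  here          = x∈p∪q⁺ (inj₂ (x∈⁅x⁆ (f zero)))
∈-image⁺ f {inside ∷ p}  (there x∈p) = x∈p∪q⁺ (inj₁ (∈-image⁺ (f ∘ suc) x∈p))
∈-image⁺ f {outside ∷ p} (there x∈p) = ∈-image⁺ (f ∘ suc) x∈p

∈-image⁻ : ∀ (f : Fin n → Fin m) p {y} → y ∈ image f p → ∃[ x ] (x ∈ p × f x ≡ y)
∈-image⁻ f []            y∈ = contradiction y∈ ∉⊥
∈-image⁻ f (outside ∷ p) y∈ with x , x∈p , eq ← ∈-image⁻ (f ∘ suc) p y∈ = suc x , there x∈p , eq
∈-image⁻ f (inside ∷ p)  y∈ with x∈p∪⁅y⁆⁻ (image (f ∘ suc) p) (f zero) y∈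
... | inj₂ refl = zero , here , refl
... | inj₁ y∈'  with x , x∈p , eq ← ∈-image⁻ (f ∘ suc) p y∈' = suc x , there x∈p , eq

InjectiveOn : (Fin n → Fin m) → Subset n → Set
InjectiveOn f p = ∀ {x y} → x ∈ p → y ∈ p → f x ≡ f y → x ≡ y

injectiveOn? : (f : Fin n → Fin m) → Decidable (InjectiveOn f)
injectiveOn? f p = map′ (λ inj {x} {y} → inj x y) (λ inj x y → inj) (all? λ x → all? λ y →
  x ∈? p →-dec y ∈? p →-dec f x ≟ᶠ f y →-dec x ≟ᶠ y)

InjectiveOn-⊆ : ∀ {f : Fin n → Fin m} {p q} → q ⊆ p → InjectiveOn f p → InjectiveOn f q
InjectiveOn-⊆ q⊆p inj x∈q y∈q = inj (q⊆p x∈q) (q⊆p y∈q)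

InjectiveOn-∷ : ∀ {f : Fin (suc n) → Fin m} {s p} → InjectiveOn f (s ∷ p) → InjectiveOn (f ∘ suc) p
InjectiveOn-∷ inj x∈p y∈p eq = Finₚ.suc-injective (inj (there x∈p) (there y∈p) eq)

InjectiveOn-∪⁅⁆ : ∀ {f : Fin n → Fin m} {p y} → InjectiveOn f p → (∀ {x} → x ∈ p → f x ≢ f y) →
                  InjectiveOn f (p ∪ ⁅ y ⁆)
InjectiveOn-∪⁅⁆ {p = p} {y} inj new x∈ y∈ eq with x∈p∪⁅y⁆⁻ p y x∈ | x∈p∪⁅y⁆⁻ p y y∈
... | inj₁ x∈p  | inj₁ y∈p  = inj x∈p y∈p eq
... | inj₁ x∈p  | inj₂ refl = contradiction eq (new x∈p)
... | inj₂ refl | inj₁ y∈p  = contradiction (sym eq) (new y∈p)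
... | inj₂ refl | inj₂ refl = refl

∣image∣≡∣p∣ : ∀ (f : Fin n → Fin m) p → InjectiveOn f p → ∣ image f p ∣ ≡ ∣ p ∣
∣image∣≡∣p∣ {m = m} f []  _   = ∣⊥∣≡0 m
∣image∣≡∣p∣ f (outside ∷ p) inj = ∣image∣≡∣p∣ (f ∘ suc) p (InjectiveOn-∷ inj)
∣image∣≡∣p∣ f (inside ∷ p)  inj =
  trans (∣p∪⁅x⁆∣≡1+∣p∣ _ f0∉) (cong suc (∣image∣≡∣p∣ (f ∘ suc) p (InjectiveOn-∷ inj)))
  where
  f0∉ : f zero ∉ image (f ∘ suc) p
  f0∉ f0∈ with x , x∈p , eq ← ∈-image⁻ (f ∘ suc) p f0∈ with () ← inj (there x∈p) here eq

InjectiveOn-exchange : ∀ {f : Fin n → Fin m} {p x y} → InjectiveOn f p → x ∈ p → f y ≡ f x →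
                       InjectiveOn f ((p - x) ∪ ⁅ y ⁆)
InjectiveOn-exchange {p = p} {x} inj x∈p fy≡fx = InjectiveOn-∪⁅⁆ (InjectiveOn-⊆ (p─q⊆p p ⁅ x ⁆) inj)
  λ z∈ fz≡fy → x∈p-y⇒x≢y p z∈ (inj (p─q⊆p p ⁅ x ⁆ z∈) x∈p (trans fz≡fy fy≡fx))

InjectiveOn⇒∉-exchange : ∀ {f : Fin n → Fin m} {p x y} → InjectiveOn f p → x ∈ p → f y ≡ f x →
                         y ∉ p - x
InjectiveOn⇒∉-exchange {p = p} {x} inj x∈p fy≡fx y∈ =
  x∈p-y⇒x≢y p y∈ (inj (p─q⊆p p ⁅ x ⁆ y∈) x∈p fy≡fx)

-- Matroids with decidable independence

HasRank-unique : (M : Matroid n) → ∀ {X r r'} → HasRank M X r → HasRank M X r' → r ≡ r'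
HasRank-unique M ((I , I⊆X , I-indep , refl) , bound) ((I' , I'⊆X , I'-indep , refl) , bound') =
  ≤-antisym (bound' I I⊆X I-indep) (bound I' I'⊆X I'-indep)

IndepMatched : Matroid n → Subset n → Subset n → Set
IndepMatched M Y X = ∀ I → I ⊆ Y → Indep I → ∃[ J ] (J ⊆ X × Indep J × ∣ J ∣ ≡ ∣ I ∣)
  where open Matroid M

IndepMatched⇒rank≤ : (M : Matroid n) → ∀ {X Y r s} →
                     HasRank M Y s → HasRank M X r → IndepMatched M Y X → s ≤ r
IndepMatched⇒rank≤ M ((I , I⊆Y , I-indep , refl) , _) (_ , bound) matched
  with J , J⊆X , J-indep , ∣J∣≡∣I∣ ← matched I I⊆Y I-indep
  = subst (_≤ _) ∣J∣≡∣I∣ (bound J J⊆X J-indep)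

module _ (M : Matroid n) (indep? : Decidable (Matroid.Indep M)) where
  open Matroid M

  rank : ∀ X → ∃[ r ] HasRank M X r
  rank X = search n (λ I _ _ → ∣p∣≤n I)
    where
    search : ∀ b → (∀ I → I ⊆ X → Indep I → ∣ I ∣ ≤ b) → ∃[ r ] HasRank M X r
    search b bounded with anySubset? (λ I → I ⊆? X ×-dec indep? I ×-dec ∣ I ∣ ≟ b)
    ... | yes attained = b , attained , bounded
    search zero    _       | no ¬attained =
      contradiction (⊥ , (λ {x} → ⊆-min X {x}) , indep-⊥ , ∣⊥∣≡0 n) ¬attained
    search (suc b) bounded | no ¬attained = search b λ I I⊆X I-indep →
      ≤-pred (≤∧≢⇒< (bounded I I⊆X I-indep) λ eq → ¬attained (I , I⊆X , I-indep , eq))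

  isFlat? : Decidable (IsFlat M)
  isFlat? F = map′ fromRank toRank (all? λ e → ¬? (e ∈? F) →-dec rk F <? rk (F ∪ ⁅ e ⁆))
    where
    rk : Subset n → ℕ
    rk = proj₁ ∘ rank
    fromRank : (∀ e → e ∉ F → rk F < rk (F ∪ ⁅ e ⁆)) → IsFlat M F
    fromRank increases e e∉F r r' rF rFe
      rewrite HasRank-unique M rF (proj₂ (rank F))
            | HasRank-unique M rFe (proj₂ (rank (F ∪ ⁅ e ⁆))) = increases e e∉F
    toRank : IsFlat M F → ∀ e → e ∉ F → rk F < rk (F ∪ ⁅ e ⁆)
    toRank flat e e∉F = flat e e∉F _ _ (proj₂ (rank F)) (proj₂ (rank (F ∪ ⁅ e ⁆)))

  flats : List (Subset n)
  flats = filter isFlat? (allSubsets n)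

  flats-listed : ListsExactly M (IsFlat M) flats
  flats-listed = Unique.filter⁺ isFlat? (allSubsets-unique n) , λ X →
    proj₂ ∘ ∈-filter⁻ isFlat? {xs = allSubsets n} , ∈-filter⁺ isFlat? (∈-allSubsets X)

  flat-∋ : ∀ {F e} → IsFlat M F → IndepMatched M (F ∪ ⁅ e ⁆) F → e ∈ F
  flat-∋ {F} {e} flat matched with e ∈? F
  ... | yes e∈F = e∈F
  ... | no e∉F  = contradiction (flat e e∉F _ _ rank[F] rank[F∪e])
                                (≤⇒≯ (IndepMatched⇒rank≤ M rank[F∪e] rank[F] matched))
    where
    rank[F]   = proj₂ (rank F)
    rank[F∪e] = proj₂ (rank (F ∪ ⁅ e ⁆))

-- Element zero is a coloop; the classes of the other elements are the fibres of cls.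
module TruncatedPartitionMatroid (k : ℕ) {n m : ℕ} (cls : Fin n → Fin m) where

  PartialTransversal : Subset n → Set
  PartialTransversal X = InjectiveOn cls X × ∣ X ∣ ≤ k

  IsIndep : Subset (suc n) → Set
  IsIndep I = PartialTransversal (tail I)

  isIndep? : Decidable IsIndep
  isIndep? I = injectiveOn? cls (tail I) ×-dec ∣ tail I ∣ ≤? k

  indep-⊆ : ∀ {I J} → J ⊆ I → IsIndep I → IsIndep J
  indep-⊆ {_ ∷ _} {_ ∷ _} J⊆I (I-inj , ∣I∣≤k) =
    InjectiveOn-⊆ (drop-∷-⊆ J⊆I) I-inj , ≤-trans (p⊆q⇒∣p∣≤∣q∣ (drop-∷-⊆ J⊆I)) ∣I∣≤k

  -- Injectivity makes |image X| = |X| < |Y| = |image Y|, so Y meets a class that X misses.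
  partialTransversal-augment : ∀ {X Y} → PartialTransversal X → PartialTransversal Y → ∣ X ∣ < ∣ Y ∣ →
                               ∃[ e ] (e ∈ Y × e ∉ X × PartialTransversal (X ∪ ⁅ e ⁆))
  partialTransversal-augment {X} {Y} (X-inj , _) (Y-inj , ∣Y∣≤k) ∣X∣<∣Y∣
    with c , c∈Y , c∉X ← ∣p∣<∣q∣⇒∃x∈q∖p {p = image cls X} {q = image cls Y}
           (subst₂ _<_ (sym (∣image∣≡∣p∣ cls X X-inj)) (sym (∣image∣≡∣p∣ cls Y Y-inj)) ∣X∣<∣Y∣)
    with e , e∈Y , refl ← ∈-image⁻ cls Y c∈Y
    = e , e∈Y , e∉X , InjectiveOn-∪⁅⁆ X-inj new-class ,
      ≤-trans (≤-reflexive (∣p∪⁅x⁆∣≡1+∣p∣ X e∉X)) (≤-trans ∣X∣<∣Y∣ ∣Y∣≤k)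
    where
    e∉X : e ∉ X
    e∉X = c∉X ∘ ∈-image⁺ cls
    new-class : ∀ {x} → x ∈ X → cls x ≢ cls e
    new-class x∈X eq = c∉X (subst (_∈ image cls X) eq (∈-image⁺ cls x∈X))

  augment-tail : ∀ {a b X Y} → IsIndep (a ∷ X) → IsIndep (b ∷ Y) → ∣ X ∣ < ∣ Y ∣ →
                 ∃[ e ] (e ∈ b ∷ Y × e ∉ a ∷ X × IsIndep ((a ∷ X) ∪ ⁅ e ⁆))
  augment-tail X-indep Y-indep ∣X∣<∣Y∣
    with e , e∈Y , e∉X , indep ← partialTransversal-augment X-indep Y-indep ∣X∣<∣Y∣
    = suc e , there e∈Y , e∉X ∘ drop-there , indep

  augment : ∀ {I J} → IsIndep I → IsIndep J → ∣ I ∣ < ∣ J ∣ →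
            ∃[ e ] (e ∈ J × e ∉ I × IsIndep (I ∪ ⁅ e ⁆))
  augment {outside ∷ X} {inside ∷ Y} X-indep _ _ =
    zero , here , (λ ()) , subst PartialTransversal (sym (∪-identityʳ X)) X-indep
  augment {inside ∷ _}  {inside ∷ _}  X-indep Y-indep (s≤s ∣X∣<∣Y∣) = augment-tail X-indep Y-indep ∣X∣<∣Y∣
  augment {outside ∷ _} {outside ∷ _} X-indep Y-indep ∣X∣<∣Y∣       = augment-tail X-indep Y-indep ∣X∣<∣Y∣
  augment {inside ∷ _}  {outside ∷ _} X-indep Y-indep 1+∣X∣<∣Y∣     =
    augment-tail X-indep Y-indep (<-trans (n<1+n _) 1+∣X∣<∣Y∣)

  matroid : Matroid (suc n)
  matroid = record
    { Indep   = IsIndep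
    ; indep-⊥ = (λ x∈⊥ → contradiction x∈⊥ ∉⊥) , ≤-trans (≤-reflexive (∣⊥∣≡0 n)) z≤n
    ; indep-⊆ = λ {I} {J} → indep-⊆ {I} {J}
    ; augment = λ {I} {J} → augment {I} {J}
    }

  -- Trading e' for e, which lies in F and in the same class, turns an independent subset of F ∪ {e'}
  -- into an equally large independent subset of F.
  flat-closed-under-class : ∀ {a X e e'} → IsFlat matroid (a ∷ X) → e ∈ X → cls e ≡ cls e' → e' ∈ X
  flat-closed-under-class {a} {X} {e} {e'} flat e∈X same-class =
    drop-there (flat-∋ matroid isIndep? flat matched)
    where
    matched : IndepMatched matroid ((a ∷ X) ∪ ⁅ suc e' ⁆) (a ∷ X)
    matched I I⊆ I-indep with suc e' ∈? I
    ... | no e'∉I = I , p⊆q∪⁅x⁆∧x∉p⇒p⊆q I⊆ e'∉I , I-indep , refl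
    matched (b ∷ Z) I⊆ (Z-inj , ∣Z∣≤k) | yes e'∈I =
      I' , I'⊆ , (InjectiveOn-exchange Z-inj e'∈Z same-class , subst (_≤ k) (sym ∣tail-I'∣≡∣Z∣) ∣Z∣≤k) ,
      ∣I'∣≡∣I∣
      where
      I' = ((b ∷ Z) - suc e') ∪ ⁅ suc e ⁆
      e'∈Z : e' ∈ Z
      e'∈Z = drop-there e'∈I
      e∉Z-e' : e ∉ Z - e'
      e∉Z-e' = InjectiveOn⇒∉-exchange Z-inj e'∈Z same-class
      ∣tail-I'∣≡∣Z∣ : ∣ (Z - e') ∪ ⁅ e ⁆ ∣ ≡ ∣ Z ∣
      ∣tail-I'∣≡∣Z∣ = ∣p-x∪⁅y⁆∣≡∣p∣ Z e'∈Z e∉Z-e'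
      ∣I'∣≡∣I∣ : ∣ I' ∣ ≡ ∣ b ∷ Z ∣
      ∣I'∣≡∣I∣ = ∣p-x∪⁅y⁆∣≡∣p∣ (b ∷ Z) e'∈I (e∉Z-e' ∘ drop-there)
      I'⊆ : I' ⊆ a ∷ X
      I'⊆ x∈I' with x∈p∪⁅y⁆⁻ ((b ∷ Z) - suc e') (suc e) x∈I'
      ... | inj₂ refl = there e∈X
      ... | inj₁ x∈I-e' with x∈p∪⁅y⁆⁻ (a ∷ X) (suc e') (I⊆ (p─q⊆p (b ∷ Z) ⁅ suc e' ⁆ x∈I-e'))
      ...   | inj₁ x∈F  = x∈F
      ...   | inj₂ refl = contradiction refl (x∈p-y⇒x≢y (b ∷ Z) x∈I-e')

  classes : Subset (suc n) → Subset (suc m)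
  classes (a ∷ X) = a ∷ image cls X

  classes-injective-on-flats : ∀ {F G} → IsFlat matroid F → IsFlat matroid G →
                               classes F ≡ classes G → F ≡ G
  classes-injective-on-flats {a ∷ X} {b ∷ Y} F-flat G-flat eq with refl , same-image ← ∷-injective eq =
    cong (a ∷_) (⊆-antisym (⊆-of-image G-flat same-image) (⊆-of-image F-flat (sym same-image)))
    where
    ⊆-of-image : ∀ {X Y} → IsFlat matroid (a ∷ Y) → image cls X ≡ image cls Y → X ⊆ Y
    ⊆-of-image {X} {Y} Y-flat same {x} x∈X
      with y , y∈Y , cls-y≡cls-x ← ∈-image⁻ cls Y (subst (cls x ∈_) same (∈-image⁺ cls x∈X))
      = flat-closed-under-class Y-flat y∈Y cls-y≡cls-x

  length-flats : length (flats matroid isIndep?) ≤ 2 ^ suc m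
  length-flats = begin
    length LF                    ≤⟨ injective⇒≤length _ (classes ∘ lookup LF) injective (∈-allSubsets ∘ _) ⟩
    length (allSubsets (suc m))  ≡⟨ length-allSubsets (suc m) ⟩
    2 ^ suc m                    ∎
    where
    open ≤-Reasoning
    LF = flats matroid isIndep?
    lookup-flat : ∀ i → IsFlat matroid (lookup LF i)
    lookup-flat i = proj₁ (proj₂ (flats-listed matroid isIndep?) _) (∈-lookup i)
    injective : Injective _≡_ _≡_ (classes ∘ lookup LF)
    injective {i} {j} eq = Unique⇒lookup-injective (proj₁ (flats-listed matroid isIndep?))
                             (classes-injective-on-flats (lookup-flat i) (lookup-flat j) eq)

  -- Non-spanning thanks to the coloop: trading an element of X for it gives an independent set
  -- of size k + 1, while the circuit has rank k.
  transversal-nonSpanningCircuit : ∀ {X} → InjectiveOn cls X → ∣ X ∣ ≡ suc k →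
                                   IsNonSpanningCircuit matroid (outside ∷ X)
  transversal-nonSpanningCircuit {X} X-inj ∣X∣≡1+k = (dependent , minimal) , nonSpanning
    where
    dependent : ¬ IsIndep (outside ∷ X)
    dependent (_ , ∣X∣≤k) = 1+n≰n (subst (_≤ k) ∣X∣≡1+k ∣X∣≤k)
    minimal : ∀ D → D ⊂ outside ∷ X → IsIndep D
    minimal (d ∷ D) D⊂X = InjectiveOn-⊆ (drop-∷-⊆ (proj₁ D⊂X)) X-inj ,
      ≤-pred (≤-trans (s≤s (∣p∣≤∣x∷p∣ d D)) (subst (∣ d ∷ D ∣ <_) ∣X∣≡1+k (p⊂q⇒∣p∣<∣q∣ D⊂X)))
    ∣indep∣≤k : ∀ {I} → I ⊆ outside ∷ X → IsIndep I → ∣ I ∣ ≤ k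
    ∣indep∣≤k {outside ∷ _} _   (_ , ∣Z∣≤k) = ∣Z∣≤k
    ∣indep∣≤k {inside ∷ _}  I⊆X _           = contradiction (I⊆X here) λ ()
    nonSpanning : ∀ r rM → HasRank matroid (outside ∷ X) r → MatroidRank matroid rM → r < rM
    nonSpanning r rM ((I , I⊆X , I-indep , refl) , _) (_ , bound)
      with x , x∈X , _ ← ∣p∣<∣q∣⇒∃x∈q∖p {p = ⊥} {q = X}
                            (subst₂ _<_ (sym (∣⊥∣≡0 n)) (sym ∣X∣≡1+k) (s≤s z≤n))
      = ≤-trans (s≤s (∣indep∣≤k I⊆X I-indep))
                (subst (_≤ rM) (cong suc ∣X-x∣≡k) (bound (inside ∷ (X - x)) ⊆⊤ basis-indep))
      where
      ∣X-x∣≡k : ∣ X - x ∣ ≡ k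
      ∣X-x∣≡k = suc-injective (trans (x∈p⇒1+∣p-x∣≡∣p∣ X x∈X) ∣X∣≡1+k)
      basis-indep : IsIndep (inside ∷ (X - x))
      basis-indep = InjectiveOn-⊆ (p─q⊆p X ⁅ x ⁆) X-inj , ≤-reflexive ∣X-x∣≡k

module _ {m p : ℕ} where

  transversal : (Fin m → Fin p) → Subset (m * p)
  transversal f = image (λ c → combine c (f c)) ⊤

  quotient-combine : ∀ (c : Fin m) (x : Fin p) → quotient {m} p (combine c x) ≡ c
  quotient-combine c x = cong proj₁ (remQuot-combine c x)

  transversal-injectiveOn : ∀ f → InjectiveOn (quotient {m} p) (transversal f)
  transversal-injectiveOn f x∈ y∈ eq
    with c , _ , refl ← ∈-image⁻ (λ c → combine c (f c)) ⊤ x∈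
       | d , _ , refl ← ∈-image⁻ (λ c → combine c (f c)) ⊤ y∈
    = cong (λ c → combine c (f c))
           (trans (sym (quotient-combine c (f c))) (trans eq (quotient-combine d (f d))))

  ∣transversal∣ : ∀ f → ∣ transversal f ∣ ≡ m
  ∣transversal∣ f =
    trans (∣image∣≡∣p∣ (λ c → combine c (f c)) ⊤ λ _ _ → combine-injectiveˡ _ _ _ _) (∣⊤∣≡n m)

  transversal-injective : ∀ {f g} → transversal f ≡ transversal g → ∀ c → f c ≡ g c
  transversal-injective {f} {g} eq c
    with d , _ , same ← ∈-image⁻ (λ c → combine c (g c)) ⊤
                          (subst (combine c (f c) ∈_) eq (∈-image⁺ (λ c → combine c (f c)) ∈⊤))
    with refl , gd≡fc ← combine-injective d (g d) c (f c) same
    = sym gd≡fc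

funToFin-cong : ∀ {m p} {f g : Fin m → Fin p} → (∀ c → f c ≡ g c) → funToFin f ≡ funToFin g
funToFin-cong {zero}  _   = refl
funToFin-cong {suc m} f≗g = cong₂ combine (f≗g zero) (funToFin-cong (f≗g ∘ suc))

finToFun-injective : ∀ {m p} {a b : Fin (p ^ m)} → (∀ c → finToFun {p} {m} a c ≡ finToFun b c) → a ≡ b
finToFun-injective {m} {p} {a} {b} same = begin
  a                               ≡⟨ funToFin-finToFin {m} {p} a ⟨
  funToFin (finToFun {p} {m} a)   ≡⟨ funToFin-cong {m} {p} same ⟩
  funToFin (finToFun {p} {m} b)   ≡⟨ funToFin-finToFin {m} {p} b ⟩
  b                               ∎
  where open ≡-Reasoning

module GridMatroid (k p : ℕ) where

  open TruncatedPartitionMatroid k (quotient {suc k} p) public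

  length-nonSpanningCircuits : ∀ LC → ListsExactly matroid (IsNonSpanningCircuit matroid) LC →
                               p ^ suc k ≤ length LC
  length-nonSpanningCircuits LC (_ , listed) = injective⇒≤length LC circuit circuit-injective λ a →
    proj₂ (listed (circuit a))
          (transversal-nonSpanningCircuit (transversal-injectiveOn (choice a)) (∣transversal∣ (choice a)))
    where
    choice : Fin (p ^ suc k) → Fin (suc k) → Fin p
    choice = finToFun
    circuit : Fin (p ^ suc k) → Subset (suc (suc k * p))
    circuit a = outside ∷ transversal (choice a)
    circuit-injective : Injective _≡_ _≡_ circuit
    circuit-injective {a} {b} eq =
      finToFun-injective (transversal-injective {f = choice a} {choice b} (cong tail eq))

-- Arithmetic

n<2^n : ∀ n → n < 2 ^ n
n<2^n zero    = s≤s z≤n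
n<2^n (suc n) = begin-strict
  suc n          ≤⟨ n<2^n n ⟩
  2 ^ n          <⟨ m<m+n (2 ^ n) (m^n>0 2 n) ⟩
  2 ^ n + 2 ^ n  ≡⟨ cong (2 ^ n +_) (+-identityʳ (2 ^ n)) ⟨
  2 ^ suc n      ∎
  where open ≤-Reasoning

2^[1+m]*[2+m*2^m]≤2^[4m] : ∀ m .{{_ : NonZero m}} → 2 ^ suc m * (2 + m * 2 ^ m) ≤ 2 ^ (4 * m)
2^[1+m]*[2+m*2^m]≤2^[4m] m@(suc k) = begin
  2 ^ suc m * (2 + m * 2 ^ m)  ≤⟨ *-monoʳ-≤ (2 ^ suc m) 2+m*2^m≤2^m*2^m ⟩
  2 ^ suc m * (2 ^ m * 2 ^ m)  ≡⟨ cong (2 ^ suc m *_) (^-distribˡ-+-* 2 m m) ⟨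
  2 ^ suc m * 2 ^ (m + m)      ≡⟨ ^-distribˡ-+-* 2 (suc m) (m + m) ⟨
  2 ^ (suc m + (m + m))        ≤⟨ ^-monoʳ-≤ 2 (≤-trans (m≤m+n _ k) (≤-reflexive (exponents k))) ⟩
  2 ^ (4 * m)                  ∎
  where
  open ≤-Reasoning
  2+m*2^m≤2^m*2^m : 2 + m * 2 ^ m ≤ 2 ^ m * 2 ^ m
  2+m*2^m≤2^m*2^m = begin
    2 + m * 2 ^ m      ≤⟨ +-monoˡ-≤ (m * 2 ^ m) (^-monoʳ-≤ 2 {1} {m} (s≤s z≤n)) ⟩
    2 ^ m + m * 2 ^ m  ≤⟨ *-monoˡ-≤ (2 ^ m) (n<2^n m) ⟩
    2 ^ m * 2 ^ m      ∎
  exponents : ∀ k → suc (suc k) + (suc k + suc k) + k ≡ 4 * suc k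
  exponents = solve-∀

polynomial-≤-2^ : ∀ c K {x a} → x ≤ 2 ^ a → suc (x + (c * x ^ K + c)) ≤ 2 ^ (suc c + a * suc K)
polynomial-≤-2^ c K {x} {a} x≤B = begin
  suc (x + (c * x ^ K + c))      ≤⟨ s≤s (+-mono-≤ x≤Q (+-monoˡ-≤ c (*-monoʳ-≤ c x^K≤Q))) ⟩
  suc (Q + (c * Q + c))          ≤⟨ s≤s (+-monoʳ-≤ Q (+-monoʳ-≤ (c * Q) (m≤m*n c Q {{m^n≢0 2 (a * suc K)}}))) ⟩
  1 + (Q + (c * Q + c * Q))      ≤⟨ +-monoˡ-≤ (Q + (c * Q + c * Q)) (m^n>0 2 (a * suc K)) ⟩
  Q + (Q + (c * Q + c * Q))      ≡⟨ coefficients Q c ⟩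
  (suc c + suc c) * Q            ≤⟨ *-monoˡ-≤ Q (+-mono-≤ (n<2^n c) (≤-trans (n<2^n c) (m≤m+n _ 0))) ⟩
  (2 ^ c + (2 ^ c + 0)) * Q      ≡⟨ ^-distribˡ-+-* 2 (suc c) (a * suc K) ⟨
  2 ^ (suc c + a * suc K)        ∎
  where
  open ≤-Reasoning
  B = 2 ^ a
  Q = 2 ^ (a * suc K)
  B^[1+K]≡Q : B ^ suc K ≡ Q
  B^[1+K]≡Q = ^-*-assoc 2 a (suc K)
  1≤B : 1 ≤ B
  1≤B = m^n>0 2 a
  1≤B^K : 1 ≤ B ^ K
  1≤B^K = subst (_≤ B ^ K) (^-zeroˡ K) (^-monoˡ-≤ K 1≤B)
  x≤Q : x ≤ Q
  x≤Q = ≤-trans x≤B (subst (B ≤_) B^[1+K]≡Q (m≤m*n B (B ^ K) {{>-nonZero 1≤B^K}}))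
  x^K≤Q : x ^ K ≤ Q
  x^K≤Q = ≤-trans (^-monoˡ-≤ K x≤B) (subst (B ^ K ≤_) B^[1+K]≡Q (m≤n*m (B ^ K) B {{>-nonZero 1≤B}}))
  coefficients : ∀ Q c → Q + (Q + (c * Q + c * Q)) ≡ (suc c + suc c) * Q
  coefficients = solve-∀

exponent-gap : ∀ c S → let m = 2 + c + 4 * S in suc c + 4 * m * S < m * m
exponent-gap c S = ≤-trans (m≤m+n _ _) (≤-reflexive (sym (expand c S)))
  where
  expand : ∀ c S → (2 + c + 4 * S) * (2 + c + 4 * S)
                 ≡ suc (suc c + 4 * (2 + c + 4 * S) * S) + (2 + c) * (1 + c + 4 * S)
  expand = solve-∀

PolynomiallyManyNonSpanningCircuits : ℕ → ℕ → Set₁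
PolynomiallyManyNonSpanningCircuits c K =
  ∀ {n} (M : Matroid n) LF → ListsExactly M (IsFlat M) LF →
    let x = length (encodeSets LF) in
    ∃[ LC ] (ListsExactly M (IsNonSpanningCircuit M) LC × length LC ≤ suc (x + (c * x ^ K + c)))

FlatsReducesToNSC⇒polynomiallyManyNonSpanningCircuits :
  FlatsReducesToNSC → ∃[ c ] ∃[ K ] PolynomiallyManyNonSpanningCircuits c K
FlatsReducesToNSC⇒polynomiallyManyNonSpanningCircuits (T , c , K , reduces) = c , K , λ M LF LF-listed →
  let (r , LC , _ , LC-listed , computes) = reduces _ M LF LF-listed in
  LC , LC-listed , ≤-trans (length-≤-encodeNSC r LC) (ComputesWithin-length T computes)

¬polynomiallyManyNonSpanningCircuits : ∀ c K → ¬ PolynomiallyManyNonSpanningCircuits c K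
¬polynomiallyManyNonSpanningCircuits c K few =
  let (LC , LC-listed , LC-short) = few matroid LF (flats-listed matroid isIndep?) in
  <-irrefl refl $ begin-strict
    2 ^ (d * d)                  ≡⟨ ^-*-assoc 2 d d ⟨
    (2 ^ d) ^ d                  ≤⟨ length-nonSpanningCircuits LC LC-listed ⟩
    length LC                    ≤⟨ LC-short ⟩
    suc (x + (c * x ^ K + c))    ≤⟨ polynomial-≤-2^ c K {a = 4 * d} x≤2^[4d] ⟩
    2 ^ (suc c + 4 * d * suc K)  <⟨ ^-monoʳ-< 2 (s≤s (s≤s z≤n)) (exponent-gap c (suc K)) ⟩
    2 ^ (d * d)                  ∎
  where
  d = 2 + c + 4 * suc K
  open GridMatroid (suc (c + 4 * suc K)) (2 ^ d)
  open ≤-Reasoning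
  LF = flats matroid isIndep?
  x = length (encodeSets LF)
  x≤2^[4d] : x ≤ 2 ^ (4 * d)
  x≤2^[4d] = begin
    x                            ≡⟨ length-encodeSets LF ⟩
    length LF * (2 + d * 2 ^ d)  ≤⟨ *-monoˡ-≤ _ length-flats ⟩
    2 ^ suc d * (2 + d * 2 ^ d)  ≤⟨ 2^[1+m]*[2+m*2^m]≤2^[4m] d ⟩
    2 ^ (4 * d)                  ∎

lemma13 : ¬ FlatsReducesToNSC
lemma13 reduces =
  let (c , K , few) = FlatsReducesToNSC⇒polynomiallyManyNonSpanningCircuits reduces in
  ¬polynomiallyManyNonSpanningCircuits c K few
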